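{- Let $w=w_1w_2\cdots w_n$ be a word over $\{0,1\}$. Then every initial segment of $w$ contains at least as many $1$'s as $0$'s if and only if every initial segment $w'$ of $w$ satisfies $\mathrm{even}(w',1)\ge\mathrm{odd}(w',0)$.
   Context: For a $01$ word $v=v_1\cdots v_m$ and $s\in\{0,1\}$, $\mathrm{odd}(v,s)=|\{i\in[m]: i \text{ odd}, v_i=s\}|$ and $\mathrm{even}(v,s)=|\{i\in[m]: i\text{ even}, v_i=s\}|$. -}

module Defs where

open import Data.Bool using (Bool; true; false; if_then_else_)
open import Data.Nat using (ℕ; zero; suc; _+_)
open import Data.List using (List; []; _∷_)
open import Relation.Nullary using (does)
open import Data.Bool.Properties using (_≟_)

-- A 01-word: letters are Bool, with false = 0 and true = 1.
Word : Set
Word = List Bool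

[_≡ᵇ_] : Bool → Bool → ℕ
[ a ≡ᵇ s ] = if does (a ≟ s) then 1 else 0

count : Bool → Word → ℕ
count s []       = 0
count s (a ∷ v)  = [ a ≡ᵇ s ] + count s v

-- odd(v,s) = #{ i odd : v_i = s },  even(v,s) = #{ i even : v_i = s },
-- positions indexed from 1.  Mutual recursion: shifting by one letter swaps parity.
odd  : Word → Bool → ℕ
even : Word → Bool → ℕ
odd  []      s = 0
odd  (a ∷ v) s = [ a ≡ᵇ s ] + even v s
even []      s = 0
even (a ∷ v) s = odd v s

-- The equivalence holds prefix by prefix.  Let a, b (resp. c, d) be the numbers of 0s and 1s
-- in odd (resp. even) positions of a word of length n.  There are ⌈n/2⌉ odd and ⌊n/2⌋ even
-- positions, so c + d ≤ a + b ≤ c + d + 1; under this constraint both  a + c ≤ b + d  and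
-- a ≤ d  amount to  2a ≤ 2d  up to the parity slack of 1.
module Submission where

open import Defs
open import Data.Bool using (Bool; true; false)
open import Data.List using (List; []; _∷_; take; length)
open import Data.Nat using (ℕ; zero; suc; _+_; _≤_; z≤n; s≤s; ⌊_/2⌋; ⌈_/2⌉)
open import Data.Nat.Properties
open import Data.Nat.Tactic.RingSolver using (solve)
open import Algebra.Properties.CommutativeSemigroup +-commutativeSemigroup using (interchange)
open import Function.Bundles using (_⇔_; mk⇔; Equivalence)
open import Relation.Binary.PropositionalEquality using (_≡_; refl; cong; cong₂; sym; subst₂; module ≡-Reasoning)

count≡odd+even : ∀ s v → count s v ≡ odd v s + even v s
count≡odd+even s []      = refl
count≡odd+even s (a ∷ v) = begin
  [ a ≡ᵇ s ] + count s v              ≡⟨ cong ([ a ≡ᵇ s ] +_) (count≡odd+even s v) ⟩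
  [ a ≡ᵇ s ] + (odd v s + even v s)   ≡⟨ cong ([ a ≡ᵇ s ] +_) (+-comm (odd v s) (even v s)) ⟩
  [ a ≡ᵇ s ] + (even v s + odd v s)   ≡⟨ +-assoc [ a ≡ᵇ s ] (even v s) (odd v s) ⟨
  [ a ≡ᵇ s ] + even v s + odd v s     ∎
  where open ≡-Reasoning

[≡ᵇfalse]+[≡ᵇtrue] : ∀ a → [ a ≡ᵇ false ] + [ a ≡ᵇ true ] ≡ 1
[≡ᵇfalse]+[≡ᵇtrue] false = refl
[≡ᵇfalse]+[≡ᵇtrue] true  = refl

odd-positions  : ∀ v → odd v false + odd v true ≡ ⌈ length v /2⌉
even-positions : ∀ v → even v false + even v true ≡ ⌊ length v /2⌋
odd-positions [] = refl
odd-positions (a ∷ v) = begin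
  [ a ≡ᵇ false ] + even v false + ([ a ≡ᵇ true ] + even v true)
    ≡⟨ interchange [ a ≡ᵇ false ] (even v false) [ a ≡ᵇ true ] (even v true) ⟩
  ([ a ≡ᵇ false ] + [ a ≡ᵇ true ]) + (even v false + even v true)
    ≡⟨ cong₂ _+_ ([≡ᵇfalse]+[≡ᵇtrue] a) (even-positions v) ⟩
  suc ⌊ length v /2⌋ ∎
  where open ≡-Reasoning
even-positions []      = refl
even-positions (a ∷ v) = odd-positions v

⌈n/2⌉≤1+⌊n/2⌋ : ∀ n → ⌈ n /2⌉ ≤ suc ⌊ n /2⌋
⌈n/2⌉≤1+⌊n/2⌋ zero          = z≤n
⌈n/2⌉≤1+⌊n/2⌋ (suc zero)    = s≤s z≤n
⌈n/2⌉≤1+⌊n/2⌋ (suc (suc n)) = s≤s (⌈n/2⌉≤1+⌊n/2⌋ n)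

m+m≤1+n+n⇒m≤n : ∀ {m n} → m + m ≤ suc (n + n) → m ≤ n
m+m≤1+n+n⇒m≤n {m} {n} le = begin
  m                  ≡⟨ n≡⌊n+n/2⌋ m ⟩
  ⌊ m + m /2⌋        ≤⟨ ⌊n/2⌋-mono le ⟩
  ⌈ n + n /2⌉        ≡⟨ sym (n≡⌈n+n/2⌉ n) ⟩
  n                  ∎
  where open ≤-Reasoning

balanced-≤⇔ : ∀ {a b c d} → c + d ≤ a + b → a + b ≤ suc (c + d) →
              a + c ≤ b + d ⇔ a ≤ d
balanced-≤⇔ {a} {b} {c} {d} cd≤ab ab≤1+cd = mk⇔ to from
  where
  open ≤-Reasoning
  to : a + c ≤ b + d → a ≤ d
  to ac≤bd = m+m≤1+n+n⇒m≤n (+-cancelʳ-≤ (b + c) (a + a) (suc (d + d)) (begin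
    a + a + (b + c)         ≡⟨ solve (a ∷ b ∷ c ∷ []) ⟩
    (a + c) + (a + b)       ≤⟨ +-mono-≤ ac≤bd ab≤1+cd ⟩
    (b + d) + suc (c + d)   ≡⟨ solve (b ∷ c ∷ d ∷ []) ⟩
    suc (d + d) + (b + c)   ∎))
  from : a ≤ d → a + c ≤ b + d
  from a≤d = +-cancelˡ-≤ a (a + c) (b + d) (begin
    a + (a + c)             ≡⟨ solve (a ∷ c ∷ []) ⟩
    (a + a) + c             ≤⟨ +-monoˡ-≤ c (+-mono-≤ a≤d a≤d) ⟩
    (d + d) + c             ≡⟨ solve (c ∷ d ∷ []) ⟩
    (c + d) + d             ≤⟨ +-monoˡ-≤ d cd≤ab ⟩
    (a + b) + d             ≡⟨ +-assoc a b d ⟩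
    a + (b + d)             ∎)

count≤⇔odd≤even : ∀ v → count false v ≤ count true v ⇔ odd v false ≤ even v true
count≤⇔odd≤even v
  rewrite count≡odd+even false v | count≡odd+even true v = balanced-≤⇔ even≤odd odd≤1+even
  where
  even≤odd : even v false + even v true ≤ odd v false + odd v true
  even≤odd = subst₂ _≤_ (sym (even-positions v)) (sym (odd-positions v))
                        (⌊n/2⌋≤⌈n/2⌉ (length v))
  odd≤1+even : odd v false + odd v true ≤ suc (even v false + even v true)
  odd≤1+even = subst₂ _≤_ (sym (odd-positions v)) (cong suc (sym (even-positions v)))
                          (⌈n/2⌉≤1+⌊n/2⌋ (length v))

lemma15 : (w : List Bool) →
    ((k : ℕ) → k ≤ length w → count false (take k w) ≤ count true (take k w))
    ⇔
    ((k : ℕ) → k ≤ length w → odd (take k w) false ≤ even (take k w) true)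
lemma15 w = mk⇔
  (λ h k k≤ → to   (count≤⇔odd≤even (take k w)) (h k k≤))
  (λ h k k≤ → from (count≤⇔odd≤even (take k w)) (h k k≤))
  where open Equivalence
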